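{- Let $Z$ be a set, $\mathcal{Y}\subseteq\mathcal{P}(Z)$, and let $\mu:\mathcal{Y}\to\mathcal{P}(Z)$ satisfy $(\mu\subseteq)$ and $(\mu PR)$. Let $U\in\mathcal{Y}$. Then for every $x\in Z$: $x\in\mu(U)$ if and only if $x\in U$ and there exists $f\in\Pi_x$ with $\mathrm{ran}(f)\cap U=\emptyset$.
   Context: $(\mu\subseteq)$: $\mu(X)\subseteq X$ for all $X\in\mathcal{Y}$. $(\mu PR)$: for all $X,Y\in\mathcal{Y}$, $X\subseteq Y$ implies $\mu(Y)\cap X\subseteq\mu(X)$. For $x\in Z$, $\mathcal{Y}_x:=\{Y\in\mathcal{Y}: x\in Y-\mu(Y)\}$ and $\Pi_x:=\Pi\mathcal{Y}_x$, the set of all functions $f$ with domain $\mathcal{Y}_x$ such that $f(Y)\in Y$ for every $Y\in\mathcal{Y}_x$ (so $\Pi_x=\{\emptyset\}$ if $\mathcal{Y}_x=\emptyset$). $\mathrm{ran}(f)$ is the range of $f$. -}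

module Defs where

open import Level using (Level; _⊔_) renaming (suc to lsuc)
open import Data.Product using (Σ; _×_; _,_; proj₁)
open import Relation.Nullary using (¬_)
open import Relation.Unary using (Pred; _∈_; _∉_; _⊆_)

Mu : ∀ {ℓ} (Z : Set ℓ) → Pred (Pred Z ℓ) ℓ → Set (lsuc ℓ)
Mu {ℓ} Z 𝒴 = (Y : Pred Z ℓ) → Y ∈ 𝒴 → Pred Z ℓ

MuSub : ∀ {ℓ} {Z : Set ℓ} {𝒴 : Pred (Pred Z ℓ) ℓ} → Mu Z 𝒴 → Set (lsuc ℓ)
MuSub {𝒴 = 𝒴} μ = ∀ X (pX : X ∈ 𝒴) → μ X pX ⊆ X

MuPR : ∀ {ℓ} {Z : Set ℓ} {𝒴 : Pred (Pred Z ℓ) ℓ} → Mu Z 𝒴 → Set (lsuc ℓ)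
MuPR {Z = Z} {𝒴 = 𝒴} μ =
  ∀ X Y (pX : X ∈ 𝒴) (pY : Y ∈ 𝒴) → X ⊆ Y →
  ∀ {z : Z} → z ∈ μ Y pY → z ∈ X → z ∈ μ X pX

𝒴[_] : ∀ {ℓ} {Z : Set ℓ} {𝒴 : Pred (Pred Z ℓ) ℓ} → Mu Z 𝒴 → Z → Set (lsuc ℓ)
𝒴[_] {ℓ} {Z} {𝒴} μ x = Σ (Pred Z ℓ) λ Y → Σ (Y ∈ 𝒴) λ pY → (x ∈ Y) × (x ∉ μ Y pY)

Π[_] : ∀ {ℓ} {Z : Set ℓ} {𝒴 : Pred (Pred Z ℓ) ℓ} → Mu Z 𝒴 → Z → Set (lsuc ℓ)
Π[_] {Z = Z} μ x = Σ (𝒴[ μ ] x → Z) λ f → ∀ (Y : 𝒴[ μ ] x) → f Y ∈ proj₁ Y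

RanDisjoint : ∀ {ℓ} {Z : Set ℓ} {𝒴 : Pred (Pred Z ℓ) ℓ} (μ : Mu Z 𝒴) {x : Z} →
              Π[ μ ] x → Pred Z ℓ → Set (lsuc ℓ)
RanDisjoint μ (f , _) U = ∀ Y → f Y ∉ U

module Submission where

-- (⇒) Let x ∈ μ(U).  For every Y ∈ 𝒴_x we have
--     Y ⊈ U: otherwise (μPR) applied to Y ⊆ U would put x into μ(Y),
--     contradicting x ∉ μ(Y).  Classically Y ⊈ U yields a point of Y
--     outside U; choosing such a point for each Y gives f ∈ Π_x with
--     ran(f) ∩ U = ∅.
-- (⇐) Let x ∈ U and f ∈ Π_x with ran(f) ∩ U = ∅.  If x ∉ μ(U), then U
--     itself belongs to 𝒴_x, and f(U) ∈ U contradicts the disjointness.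

open import Defs
open import Level using (Level)
open import Data.Product using (Σ; _×_; _,_; proj₁; proj₂)
open import Function.Bundles using (_⇔_; mk⇔)
open import Relation.Unary using (Pred; _∈_; _∉_; _⊆_)
open import Relation.Nullary using (¬_)
open import Axiom.ExcludedMiddle using (ExcludedMiddle)
open import Axiom.DoubleNegationElimination
  using (DoubleNegationElimination; em⇒dne)

private
  variable
    ℓ : Level

-- Classically, a set that is not contained in U has a point outside U.
-- This is where the choice of f(Y) in the forward direction comes from.
non-inclusion-witness : {Z : Set ℓ} → DoubleNegationElimination ℓ →
  (Y U : Pred Z ℓ) → ¬ (Y ⊆ U) → Σ Z (λ y → y ∈ Y × y ∉ U)
non-inclusion-witness dne Y U Y⊈U =
  dne λ noWitness → Y⊈U λ {y} y∈Y → dne λ y∉U → noWitness (y , y∈Y , y∉U)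

-- If x ∈ μ(U), no member Y of 𝒴_x is contained in U: by (μPR) the
-- inclusion Y ⊆ U would give x ∈ μ(U) ∩ Y ⊆ μ(Y), but x ∉ μ(Y).
member-of-𝒴ₓ-not-inside : {Z : Set ℓ} {𝒴 : Pred (Pred Z ℓ) ℓ} →
  (μ : Mu Z 𝒴) → MuPR μ →
  ∀ {U} (pU : U ∈ 𝒴) {x} → x ∈ μ U pU →
  (Y : 𝒴[ μ ] x) → ¬ (proj₁ Y ⊆ U)
member-of-𝒴ₓ-not-inside μ pr pU x∈μU (Y , pY , x∈Y , x∉μY) Y⊆U =
  x∉μY (pr Y _ pY pU Y⊆U x∈μU x∈Y)

disjoint-selector : {Z : Set ℓ} {𝒴 : Pred (Pred Z ℓ) ℓ} →
  DoubleNegationElimination ℓ → (μ : Mu Z 𝒴) → MuPR μ →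
  ∀ {U} (pU : U ∈ 𝒴) {x} → x ∈ μ U pU →
  Σ (Π[ μ ] x) λ f → RanDisjoint μ f U
disjoint-selector dne μ pr {U} pU x∈μU =
  ((λ Y → proj₁ (outside Y)) , (λ Y → proj₁ (proj₂ (outside Y))))
  , (λ Y → proj₂ (proj₂ (outside Y)))
  where
  outside : ∀ Y → Σ _ (λ y → y ∈ proj₁ Y × y ∉ U)
  outside Y = non-inclusion-witness dne (proj₁ Y) U
                (member-of-𝒴ₓ-not-inside μ pr pU x∈μU Y)

selector-excludes-non-membership : {Z : Set ℓ} {𝒴 : Pred (Pred Z ℓ) ℓ} →
  (μ : Mu Z 𝒴) →
  ∀ {U} (pU : U ∈ 𝒴) {x} → x ∈ U →
  (f : Π[ μ ] x) → RanDisjoint μ f U → ¬ (x ∉ μ U pU)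
selector-excludes-non-membership μ {U} pU {x} x∈U (f , f∈) avoidsU x∉μU =
  avoidsU Uₓ (f∈ Uₓ)
  where
  Uₓ : 𝒴[ μ ] x
  Uₓ = U , pU , x∈U , x∉μU

claim3p2 : ∀ {ℓ} → ExcludedMiddle ℓ →
    (Z : Set ℓ) (𝒴 : Pred (Pred Z ℓ) ℓ) (μ : Mu Z 𝒴) →
    MuSub μ → MuPR μ →
    (U : Pred Z ℓ) (pU : U ∈ 𝒴) (x : Z) →
    (x ∈ μ U pU) ⇔ ((x ∈ U) × Σ (Π[ μ ] x) λ f → RanDisjoint μ f U)
claim3p2 em Z 𝒴 μ sub pr U pU x = mk⇔
  (λ x∈μU → sub U pU x∈μU , disjoint-selector dne μ pr pU x∈μU)
  (λ (x∈U , f , avoidsU) →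
     dne (selector-excludes-non-membership μ pU x∈U f avoidsU))
  where
  dne : DoubleNegationElimination _
  dne = em⇒dne em
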